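{- Let $k\ge 3$ and $n\ge 2$ be integers and let $\mathcal{H}_{k,n}$ be the hinge graph obtained by gluing $n$ copies $C_1,\dots,C_n$ of the $k$-cycle along one common edge $xy$. For $i=1,\dots,n$ let $u_i$ be the non-shared vertex of $C_i$ adjacent to $x$, and for $i=1,\dots,n-1$ let $\eta_{x,y,i}=u_i-u_{i+1}$ (the divisor with $1$ at $u_i$, $-1$ at $u_{i+1}$, and $0$ elsewhere). Then the divisors $\eta_{x,y,1},\dots,\eta_{x,y,n-1}$ are linearly independent over $\mathbb{Z}/(k-1)\mathbb{Z}$ in the critical group: if integers $a_1,\dots,a_{n-1}$ with $0\le a_i\le k-2$ satisfy that $a_1\eta_{x,y,1}+\cdots+a_{n-1}\eta_{x,y,n-1}$ is linearly equivalent to the zero divisor, then $a_1=\cdots=a_{n-1}=0$.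
   Context: The hinge graph $\mathcal{H}_{k,n}$ is the simple graph with two distinguished ("shared") vertices $x,y$ joined by an edge $xy$, together with $n$ internally vertex-disjoint paths from $x$ to $y$, each having $k-2$ internal vertices; each such path together with the edge $xy$ forms a $k$-cycle $C_i$. A divisor is a formal $\mathbb{Z}$-linear combination of vertices; two divisors are linearly equivalent if their difference lies in the image of the graph Laplacian (equivalently, one is obtained from the other by chip-firing moves, where firing a vertex $w$ decreases its value by its valence and increases each neighbor's value by $1$). The critical group is the group of degree-zero divisors modulo linear equivalence. -}

module Defs where

open import Data.Nat as ℕ using (ℕ; zero; suc; _∸_)
open import Data.Bool using (Bool; true; false; _∧_; _∨_; if_then_else_)
open import Data.Fin using (Fin; toℕ)
open import Data.Fin.Properties using () renaming (_≟_ to _≟ᶠ_)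
open import Data.List using (List; []; _∷_; map; concatMap; foldr)
open import Data.List using (allFin) public
open import Data.Integer as ℤ using (ℤ; +_; _-_)
open import Data.Product using (∃)
open import Relation.Binary.PropositionalEquality using (_≡_)
open import Relation.Nullary.Decidable using (⌊_⌋)

-- Vertices of the hinge graph H_{k,n}: the two shared vertices x, y and,
-- for each path i : Fin n, its k-2 internal vertices  p i j  (j : Fin (k-2)),
-- ordered from the x-end (j = 0) to the y-end (j = k-3).
data HVert (k n : ℕ) : Set where
  vx : HVert k n
  vy : HVert k n
  vp : Fin n → Fin (k ∸ 2) → HVert k n

_==_ : ℕ → ℕ → Bool
m == n = ⌊ m ℕ.≟ n ⌋

adj : {k n : ℕ} → HVert k n → HVert k n → Bool
adj vx vx = false
adj vy vy = false
adj vx vy = true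
adj vy vx = true
adj vx (vp i j) = toℕ j == 0
adj (vp i j) vx = toℕ j == 0
adj {k} vy (vp i j) = suc (toℕ j) == (k ∸ 2)
adj {k} (vp i j) vy = suc (toℕ j) == (k ∸ 2)
adj (vp i j) (vp i' j') =
  ⌊ i ≟ᶠ i' ⌋ ∧ ((suc (toℕ j) == toℕ j') ∨ (suc (toℕ j') == toℕ j))

allV : (k n : ℕ) → List (HVert k n)
allV k n = vx ∷ vy ∷ concatMap (λ i → map (vp i) (allFin (k ∸ 2))) (allFin n)

sumℤ : List ℤ → ℤ
sumℤ = foldr ℤ._+_ (+ 0)

Divisor : (k n : ℕ) → Set
Divisor k n = HVert k n → ℤ

laplacian : {k n : ℕ} → (HVert k n → ℤ) → Divisor k n
laplacian {k} {n} f v =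
  sumℤ (map (λ w → if adj v w then f v - f w else + 0) (allV k n))

_∼_ : {k n : ℕ} → Divisor k n → Divisor k n → Set
_∼_ {k} {n} D D' = ∃ λ (f : HVert k n → ℤ) → ∀ v → D v - D' v ≡ laplacian f v

zeroDiv : {k n : ℕ} → Divisor k n
zeroDiv _ = + 0

-- Indicator divisor of u_j (0-based index j): the vertex of path j adjacent to x.
uInd : {k n : ℕ} → ℕ → Divisor k n
uInd j (vp i l) = if (toℕ i == j) ∧ (toℕ l == 0) then + 1 else + 0
uInd j _ = + 0

-- η_j = u_j - u_{j+1}  (0-based: η_j for j = 0 .. n-2 is the paper's η_{x,y,j+1}).
eta : {k n : ℕ} → ℕ → Divisor k n
eta j v = uInd j v - uInd (suc j) v

etaComb : {k n : ℕ} → (Fin (n ∸ 1) → ℕ) → Divisor k n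
etaComb {k} {n} a v = sumℤ (map (λ i → + a i ℤ.* eta (toℕ i) v) (allFin (n ∸ 1)))

{-# OPTIONS --safe #-}
module Submission where

-- Let f be a firing script with L f = Σ aᵢ ηᵢ.  Read along the i-th path, f is harmonic at
-- every internal vertex except uᵢ, where its Laplacian is the coefficient cᵢ = aᵢ − aᵢ₋₁ of uᵢ
-- (with a₋₁ = aₙ₋₁ = 0); so f has a constant slope eᵢ from uᵢ to y, and
-- f y − f x = cᵢ + (k − 1) eᵢ.  Combined with the equations at x and y this gives
-- (n + k − 1)(f y − f x) = 0, hence f y = f x and k − 1 divides every cᵢ.  As 0 ≤ aᵢ ≤ k − 2,
-- induction on i from a₀ = c₀ gives aᵢ = 0.

open import Defs
open import Data.Bool using (Bool; true; false; _∧_; _∨_; if_then_else_)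
open import Data.Bool.Properties using (∧-identityʳ; ∧-zeroʳ)
open import Data.Nat using (ℕ; zero; suc; _∸_; _≤_; _<_; _≡ᵇ_; z≤n; s≤s)
import Data.Nat.Properties as ℕ
open import Data.Nat.Divisibility using (>⇒∤)
open import Data.Fin using (Fin; toℕ; fromℕ<) renaming (zero to fzero; suc to fsuc)
open import Data.Fin.Properties using (_≟_; toℕ<n; toℕ-fromℕ<)
open import Data.List using (List; []; _∷_; _++_; map; concatMap; tabulate)
open import Data.List.Properties using (map-++; map-tabulate; map-∘)
open import Data.Integer using (ℤ; +_; _+_; _-_; _*_; -_)
import Data.Integer.Properties as ℤ
open import Data.Integer.Divisibility.Signed using (_∣_; divides; ∣⇒∣ᵤ)
open import Data.Integer.Tactic.RingSolver using (solve-∀)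
open import Algebra.Properties.Semiring.Sum ℤ.+-*-semiring
  using (sum; sum-syntax; ∑-distrib-+; sum-cong-≗; sum-replicate-zero; *-distribˡ-sum)
open import Data.Product using (_×_; _,_; proj₁; proj₂)
open import Function using (_∘_)
open import Relation.Binary.PropositionalEquality
open import Relation.Nullary.Negation using (contradiction)
open import Relation.Nullary.Decidable using (⌊_⌋; ⌊⌋-map′; isYes≗does)

[_]·_ : Bool → ℤ → ℤ
[ b ]· x = if b then x else + 0

infix 8 [_]·_

==-≡ᵇ : ∀ m n → (m == n) ≡ (m ≡ᵇ n)
==-≡ᵇ m n = trans (⌊⌋-map′ _ _ _) (isYes≗does _)

≡ᵇ-sym : ∀ m n → (m ≡ᵇ n) ≡ (n ≡ᵇ m)
≡ᵇ-sym zero    zero    = refl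
≡ᵇ-sym zero    (suc n) = refl
≡ᵇ-sym (suc m) zero    = refl
≡ᵇ-sym (suc m) (suc n) = ≡ᵇ-sym m n

suc-≡ᵇ-exclusive : ∀ p q → ((suc p ≡ᵇ q) ∧ (suc q ≡ᵇ p)) ≡ false
suc-≡ᵇ-exclusive p       zero    = refl
suc-≡ᵇ-exclusive zero    (suc q) = ∧-zeroʳ _
suc-≡ᵇ-exclusive (suc p) (suc q) = suc-≡ᵇ-exclusive p q

[]·-∨ : ∀ b c → (b ∧ c) ≡ false → ∀ x → [ b ∨ c ]· x ≡ [ b ]· x + [ c ]· x
[]·-∨ true  false _ x = sym (ℤ.+-identityʳ x)
[]·-∨ false c     _ x = sym (ℤ.+-identityˡ ([ c ]· x))

[]·-∧ : ∀ b c x → [ b ∧ c ]· x ≡ [ b ]· [ c ]· x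
[]·-∧ true  c x = refl
[]·-∧ false c x = refl

*-[]·-difference : ∀ b c x → x * ([ b ]· + 1 - [ c ]· + 1) ≡ [ b ]· x - [ c ]· x
*-[]·-difference true  true  x = trans (ℤ.*-zeroʳ x) (sym (ℤ.+-inverseʳ x))
*-[]·-difference true  false x = trans (ℤ.*-identityʳ x) (sym (ℤ.+-identityʳ x))
*-[]·-difference false true  x =
  trans (ℤ.*-comm x (- + 1)) (trans (ℤ.-1*i≡-i x) (sym (ℤ.+-identityˡ (- x))))
*-[]·-difference false false x = ℤ.*-zeroʳ x

extend : ∀ {A : Set} {N} → (Fin N → A) → A → ℕ → A
extend {N = zero}  t d q       = d
extend {N = suc N} t d zero    = t fzero
extend {N = suc N} t d (suc q) = extend (t ∘ fsuc) d q

extend-toℕ : ∀ {A : Set} {N} (t : Fin N → A) d (j : Fin N) → extend t d (toℕ j) ≡ t j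
extend-toℕ t d fzero    = refl
extend-toℕ t d (fsuc j) = extend-toℕ (t ∘ fsuc) d j

extend-≥ : ∀ {A : Set} {N} (t : Fin N → A) d {q} → N ≤ q → extend t d q ≡ d
extend-≥ {N = zero}  t d _         = refl
extend-≥ {N = suc N} t d (s≤s N≤q) = extend-≥ (t ∘ fsuc) d N≤q

extend-map : ∀ {A B : Set} {N} (g : A → B) (t : Fin N → A) d q →
             extend (g ∘ t) (g d) q ≡ g (extend t d q)
extend-map {N = zero}  g t d q       = refl
extend-map {N = suc N} g t d zero    = refl
extend-map {N = suc N} g t d (suc q) = extend-map g (t ∘ fsuc) d q

extend-minus : ∀ {N} (t : Fin N → ℤ) c d {q} → q < N →
               extend (λ j → c - t j) (+ 0) q ≡ c - extend t d q
extend-minus {suc N} t c d {zero}  _         = refl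
extend-minus {suc N} t c d {suc q} (s≤s q<N) = extend-minus (t ∘ fsuc) c d q<N

extend-≤ : ∀ {N B} (t : Fin N → ℕ) → (∀ j → t j ≤ B) → ∀ q → extend t 0 q ≤ B
extend-≤ {zero}  t t≤B q       = z≤n
extend-≤ {suc N} t t≤B zero    = t≤B fzero
extend-≤ {suc N} t t≤B (suc q) = extend-≤ (t ∘ fsuc) (t≤B ∘ fsuc) q

infixr 5 _◂_

_◂_ : ∀ {A : Set} → A → (ℕ → A) → ℕ → A
(x ◂ s) zero    = x
(x ◂ s) (suc q) = s q

◂-extend-map : ∀ {A B : Set} {N} (g : A → B) x (t : Fin N → A) d q →
               (g x ◂ extend (g ∘ t) (g d)) q ≡ g ((x ◂ extend t d) q)
◂-extend-map g x t d zero    = refl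
◂-extend-map g x t d (suc q) = extend-map g t d q

sumℤ-tabulate : ∀ {N} (t : Fin N → ℤ) → sumℤ (tabulate t) ≡ sum t
sumℤ-tabulate {zero}  t = refl
sumℤ-tabulate {suc N} t = cong (_+_ (t fzero)) (sumℤ-tabulate (t ∘ fsuc))

sumℤ-map-allFin : ∀ {N} (t : Fin N → ℤ) → sumℤ (map t (allFin N)) ≡ sum t
sumℤ-map-allFin t = trans (cong sumℤ (map-tabulate (λ j → j) t)) (sumℤ-tabulate t)

sumℤ-++ : ∀ xs ys → sumℤ (xs ++ ys) ≡ sumℤ xs + sumℤ ys
sumℤ-++ []       ys = sym (ℤ.+-identityˡ _)
sumℤ-++ (x ∷ xs) ys = trans (cong (_+_ x) (sumℤ-++ xs ys)) (sym (ℤ.+-assoc x _ _))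

sumℤ-concatMap : ∀ {A B : Set} (g : B → ℤ) (F : A → List B) xs →
                 sumℤ (map g (concatMap F xs)) ≡ sumℤ (map (λ x → sumℤ (map g (F x))) xs)
sumℤ-concatMap g F []       = refl
sumℤ-concatMap g F (x ∷ xs) = begin
  sumℤ (map g (F x ++ concatMap F xs))
    ≡⟨ cong sumℤ (map-++ g (F x) _) ⟩
  sumℤ (map g (F x) ++ map g (concatMap F xs))
    ≡⟨ sumℤ-++ (map g (F x)) _ ⟩
  sumℤ (map g (F x)) + sumℤ (map g (concatMap F xs))
    ≡⟨ cong (_+_ (sumℤ (map g (F x)))) (sumℤ-concatMap g F xs) ⟩
  sumℤ (map g (F x)) + sumℤ (map (λ y → sumℤ (map g (F y))) xs) ∎
  where open ≡-Reasoning

∑-neg : ∀ {N} (t : Fin N → ℤ) → ∑[ i < N ] (- t i) ≡ - sum t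
∑-neg {zero}  t = refl
∑-neg {suc N} t = trans (cong (_+_ (- t fzero)) (∑-neg (t ∘ fsuc)))
                        (sym (ℤ.neg-distrib-+ (t fzero) (sum (t ∘ fsuc))))

∑-distrib-- : ∀ {N} (s t : Fin N → ℤ) → ∑[ i < N ] (s i - t i) ≡ sum s - sum t
∑-distrib-- s t = trans (∑-distrib-+ s (-_ ∘ t)) (cong (_+_ (sum s)) (∑-neg t))

∑-const : ∀ N x → ∑[ i < N ] x ≡ + N * x
∑-const zero    x = sym (ℤ.*-zeroˡ x)
∑-const (suc N) x = trans (cong (_+_ x) (∑-const N x)) (sym (ℤ.suc-* (+ N) x))

∑-[]· : ∀ {N} b (s : Fin N → ℤ) → ∑[ i < N ] ([ b ]· s i) ≡ [ b ]· sum s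
∑-[]· true      s = refl
∑-[]· {N} false s = sum-replicate-zero N

∑-δ : ∀ {N} (t : Fin N → ℤ) q → ∑[ j < N ] ([ toℕ j ≡ᵇ q ]· t j) ≡ extend t (+ 0) q
∑-δ {zero}  t q       = refl
∑-δ {suc N} t zero    = trans (cong (_+_ (t fzero)) (sum-replicate-zero N)) (ℤ.+-identityʳ _)
∑-δ {suc N} t (suc q) = trans (ℤ.+-identityˡ _) (∑-δ (t ∘ fsuc) q)

∑-δ-shift : ∀ {N} (t : Fin N → ℤ) q →
            ∑[ j < N ] ([ suc (toℕ j) ≡ᵇ q ]· t j) ≡ (+ 0 ◂ extend t (+ 0)) q
∑-δ-shift {N} t zero    = sum-replicate-zero N
∑-δ-shift     t (suc q) = ∑-δ t q

∑-δ-Fin : ∀ {N} (i : Fin N) (t : Fin N → ℤ) → ∑[ j < N ] ([ ⌊ i ≟ j ⌋ ]· t j) ≡ t i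
∑-δ-Fin {suc N} fzero    t = trans (cong (_+_ (t fzero)) (sum-replicate-zero N)) (ℤ.+-identityʳ _)
∑-δ-Fin {suc N} (fsuc i) t = trans (ℤ.+-identityˡ _) (trans
  (sum-cong-≗ (λ j → cong ([_]· t (fsuc j)) (⌊⌋-map′ _ _ (i ≟ j))))
  (∑-δ-Fin i (t ∘ fsuc)))

pathLaplacian : (ℕ → ℤ) → ℕ → ℤ
pathLaplacian G p = (G (suc p) - G p) + (G (suc p) - G (suc (suc p)))

constant-on-interval : ∀ {A : Set} (d : ℕ → A) {N} → (∀ p → p < N → d p ≡ d (suc p)) →
                       ∀ p → p ≤ N → d 0 ≡ d p
constant-on-interval d step zero    _   = refl
constant-on-interval d step (suc p) p<N =
  trans (constant-on-interval d step p (ℕ.<⇒≤ p<N)) (step p p<N)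

minus-telescope : ∀ a b c → c - a ≡ (c - b) + (b - a)
minus-telescope = solve-∀

arithmetic-progression : ∀ (G : ℕ → ℤ) e N → (∀ p → p < N → G (suc p) - G p ≡ e) →
                         G N - G 0 ≡ + N * e
arithmetic-progression G e zero    _    = ℤ.+-inverseʳ (G 0)
arithmetic-progression G e (suc N) step = begin
  G (suc N) - G 0                   ≡⟨ minus-telescope (G 0) (G N) (G (suc N)) ⟩
  (G (suc N) - G N) + (G N - G 0)   ≡⟨ cong₂ _+_ (step N ℕ.≤-refl) progression ⟩
  e + + N * e                       ≡⟨ ℤ.suc-* (+ N) e ⟨
  + suc N * e                       ∎
  where
  open ≡-Reasoning
  progression : G N - G 0 ≡ + N * e
  progression = arithmetic-progression G e N (λ p p<N → step p (ℕ.m<n⇒m<1+n p<N))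

harmonic-path : ∀ (G : ℕ → ℤ) m c → pathLaplacian G 0 ≡ c →
                (∀ p → p < m → pathLaplacian G (suc p) ≡ + 0) →
                let e = G (suc (suc m)) - G (suc m) in
                (G 1 - G 0 ≡ c + e) × (G (suc (suc m)) - G 0 ≡ c + + suc (suc m) * e)
harmonic-path G m c at-first at-interior = first-step , total-rise
  where
  open ≡-Reasoning
  d : ℕ → ℤ
  d q = G (suc (suc q)) - G (suc q)

  flat : ∀ p → p < m → d p ≡ d (suc p)
  flat p p<m = ℤ.i-j≡0⇒i≡j (d p) (d (suc p))
    (trans (second-difference (G (suc p)) (G (suc (suc p))) (G (suc (suc (suc p))))) (at-interior p p<m))
    where
    second-difference : ∀ a b c → (b - a) - (c - b) ≡ (b - a) + (b - c)
    second-difference = solve-∀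

  constant-slope : ∀ p → p < suc m → d p ≡ d m
  constant-slope p p<1+m = trans (sym (constant-on-interval d flat p (ℕ.≤-pred p<1+m)))
                                 (constant-on-interval d flat m ℕ.≤-refl)

  first-step : G 1 - G 0 ≡ c + d m
  first-step = begin
    G 1 - G 0                        ≡⟨ peel (G 0) (G 1) (G 2) ⟩
    pathLaplacian G 0 + d 0          ≡⟨ cong₂ _+_ at-first (constant-slope 0 (s≤s z≤n)) ⟩
    c + d m                          ∎
    where
    peel : ∀ a b c → b - a ≡ ((b - a) + (b - c)) + (c - b)
    peel = solve-∀

  total-rise : G (suc (suc m)) - G 0 ≡ c + + suc (suc m) * d m
  total-rise = begin
    G (suc (suc m)) - G 0
      ≡⟨ minus-telescope (G 0) (G 1) (G (suc (suc m))) ⟩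
    (G (suc (suc m)) - G 1) + (G 1 - G 0)
      ≡⟨ cong₂ _+_ (arithmetic-progression (G ∘ suc) (d m) (suc m) constant-slope) first-step ⟩
    + suc m * d m + (c + d m)
      ≡⟨ regroup c (d m) (+ suc m * d m) ⟩
    c + (d m + + suc m * d m)
      ≡⟨ cong (_+_ c) (ℤ.suc-* (+ suc m) (d m)) ⟨
    c + + suc (suc m) * d m ∎
    where
    regroup : ∀ c e s → s + (c + e) ≡ c + (e + s)
    regroup = solve-∀

multiple-below⇒zero : ∀ {M x} → + M ∣ + x → x < M → x ≡ 0
multiple-below⇒zero {x = zero}  _    _   = refl
multiple-below⇒zero {x = suc x} M∣x x<M = contradiction (∣⇒∣ᵤ M∣x) (>⇒∤ x<M)

divisible-differences⇒zero : ∀ {M N} (α : ℕ → ℕ) → (∀ q → α q < M) →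
                             (∀ q → q < N → + M ∣ + α q - + (0 ◂ α) q) →
                             ∀ q → q < N → α q ≡ 0
divisible-differences⇒zero {M} α α<M M∣Δ zero    0<N =
  multiple-below⇒zero (subst (+ M ∣_) (ℤ.+-identityʳ (+ α 0)) (M∣Δ 0 0<N)) (α<M 0)
divisible-differences⇒zero {M} α α<M M∣Δ (suc q) q<N =
  multiple-below⇒zero (subst (+ M ∣_) previous-vanishes (M∣Δ (suc q) q<N)) (α<M (suc q))
  where
  previous-vanishes : + α (suc q) - + α q ≡ + α (suc q)
  previous-vanishes =
    trans (cong (λ z → + α (suc q) - + z) (divisible-differences⇒zero α α<M M∣Δ q (ℕ.<⇒≤ q<N)))
          (ℤ.+-identityʳ (+ α (suc q)))

balance-at-shared-vertices : ∀ {n} (M X Y : ℤ) (u c e : Fin n → ℤ) →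
  (∀ i → u i - X ≡ c i + e i) → (∀ i → Y - X ≡ c i + M * e i) →
  + 0 ≡ (X - Y) + ∑[ i < n ] (X - u i) → + 0 ≡ (Y - X) + sum e →
  (M + + n) * (Y - X) ≡ + 0
balance-at-shared-vertices {n} M X Y u c e first-edge path at-x at-y = begin
  (M + + n) * (Y - X)
    ≡⟨ combination M (+ n) X Y S E ⟩
  (+ n * (Y - X) - (S + M * E)) - ((X - Y) + - (S + E)) + (M - + 1) * ((Y - X) + E)
    ≡⟨ cong₂ (λ z w → z - w + (M - + 1) * ((Y - X) + E)) (ℤ.i≡j⇒i-j≡0 paths) (sym at-x′) ⟩
  + 0 - + 0 + (M - + 1) * ((Y - X) + E)
    ≡⟨ cong (λ w → + 0 - + 0 + (M - + 1) * w) (sym at-y) ⟩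
  + 0 + (M - + 1) * + 0
    ≡⟨ trans (ℤ.+-identityˡ _) (ℤ.*-zeroʳ (M - + 1)) ⟩
  + 0 ∎
  where
  open ≡-Reasoning
  S E : ℤ
  S = sum c
  E = sum e
  -- Add the summed path equations, subtract the equation at x, and add M − 1 times that at y.
  combination : ∀ M n X Y S E → (M + n) * (Y - X) ≡
    (n * (Y - X) - (S + M * E)) - ((X - Y) + - (S + E)) + (M - + 1) * ((Y - X) + E)
  combination = solve-∀
  reverse : ∀ X u → X - u ≡ - (u - X)
  reverse = solve-∀
  paths : + n * (Y - X) ≡ S + M * E
  paths = begin
    + n * (Y - X)                ≡⟨ ∑-const n (Y - X) ⟨
    ∑[ i < n ] (Y - X)           ≡⟨ sum-cong-≗ path ⟩
    ∑[ i < n ] (c i + M * e i)   ≡⟨ ∑-distrib-+ c (λ i → M * e i) ⟩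
    S + ∑[ i < n ] (M * e i)     ≡⟨ cong (_+_ S) (*-distribˡ-sum M e) ⟨
    S + M * E                    ∎
  at-x′ : + 0 ≡ (X - Y) + - (S + E)
  at-x′ = trans at-x (cong (_+_ (X - Y)) (begin
    ∑[ i < n ] (X - u i)
      ≡⟨ sum-cong-≗ (λ i → trans (reverse X (u i)) (cong -_ (first-edge i))) ⟩
    ∑[ i < n ] (- (c i + e i))   ≡⟨ ∑-neg (λ i → c i + e i) ⟩
    - ∑[ i < n ] (c i + e i)     ≡⟨ cong -_ (∑-distrib-+ c e) ⟩
    - (S + E)                    ∎))

-- X, h 0, …, h (N − 1), Y, Y, …: the values of a function read along a path from x to y.
profile : ∀ {N} → ℤ → (Fin N → ℤ) → ℤ → ℕ → ℤ
profile X h Y = X ◂ extend h Y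

profile-end : ∀ {N} X (h : Fin N → ℤ) Y → profile X h Y (suc N) ≡ Y
profile-end X h Y = extend-≥ h Y ℕ.≤-refl

profile-before : ∀ {N} X (h : Fin N → ℤ) c Y {p} → p ≤ N →
                 [ p ≡ᵇ 0 ]· (c - X) + (+ 0 ◂ extend (λ j → c - h j) (+ 0)) p ≡
                 c - profile X h Y p
profile-before X h c Y {zero}  _   = ℤ.+-identityʳ (c - X)
profile-before X h c Y {suc p} p<N = trans (ℤ.+-identityˡ _) (extend-minus h c Y p<N)

profile-after : ∀ {N} X (h : Fin N → ℤ) c Y {q} → q ≤ N →
                [ q ≡ᵇ N ]· (c - Y) + extend (λ j → c - h j) (+ 0) q ≡
                c - profile X h Y (suc q)
profile-after {zero}  X h c Y {zero}  _         = ℤ.+-identityʳ (c - Y)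
profile-after {suc N} X h c Y {zero}  _         = ℤ.+-identityˡ (c - h fzero)
profile-after {suc N} X h c Y {suc q} (s≤s q≤N) = profile-after X (h ∘ fsuc) c Y q≤N

laplacian-split : ∀ {k n} (f : HVert k n → ℤ) v → laplacian f v ≡
  [ adj v vx ]· (f v - f vx) + ([ adj v vy ]· (f v - f vy) +
  ∑[ i < n ] ∑[ j < k ∸ 2 ] ([ adj v (vp i j) ]· (f v - f (vp i j))))
laplacian-split {k} {n} f v = cong (λ rest → T vx + (T vy + rest)) (begin
  sumℤ (map T (concatMap (λ i → map (vp i) (allFin (k ∸ 2))) (allFin n)))
    ≡⟨ sumℤ-concatMap T _ (allFin n) ⟩
  sumℤ (map (λ i → sumℤ (map T (map (vp i) (allFin (k ∸ 2))))) (allFin n))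
    ≡⟨ sumℤ-map-allFin (λ i → sumℤ (map T (map (vp i) (allFin (k ∸ 2))))) ⟩
  ∑[ i < n ] sumℤ (map T (map (vp i) (allFin (k ∸ 2))))
    ≡⟨ sum-cong-≗ (λ i → trans (cong sumℤ (sym (map-∘ {g = T} (allFin (k ∸ 2)))))
                               (sumℤ-map-allFin (T ∘ vp i))) ⟩
  ∑[ i < n ] ∑[ j < k ∸ 2 ] T (vp i j) ∎)
  where
  open ≡-Reasoning
  T : HVert k n → ℤ
  T w = [ adj v w ]· (f v - f w)

module _ {m n : ℕ} (f : HVert (suc (suc (suc m))) n → ℤ) where

  pathProfile : Fin n → ℕ → ℤ
  pathProfile i = profile (f vx) (f ∘ vp i) (f vy)

  laplacian-vx : laplacian f vx ≡ (f vx - f vy) + ∑[ i < n ] (f vx - pathProfile i 1)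
  laplacian-vx = trans (laplacian-split f vx) (trans (ℤ.+-identityˡ _)
    (cong (_+_ (f vx - f vy)) (sum-cong-≗ (λ i → ∑-δ (λ j → f vx - f (vp i j)) 0))))

  laplacian-vy : laplacian f vy ≡ (f vy - f vx) + ∑[ i < n ] (f vy - pathProfile i (suc m))
  laplacian-vy = trans (laplacian-split f vy) (cong (_+_ (f vy - f vx)) (trans (ℤ.+-identityˡ _)
    (sum-cong-≗ (λ i → begin
      ∑[ j < suc m ] ([ suc (toℕ j) == suc m ]· (f vy - f (vp i j)))
        ≡⟨ sum-cong-≗ (λ j → cong ([_]· (f vy - f (vp i j))) (==-≡ᵇ (suc (toℕ j)) (suc m))) ⟩
      ∑[ j < suc m ] ([ toℕ j ≡ᵇ m ]· (f vy - f (vp i j)))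
        ≡⟨ ∑-δ (λ j → f vy - f (vp i j)) m ⟩
      extend (λ j → f vy - f (vp i j)) (+ 0) m
        ≡⟨ extend-minus (f ∘ vp i) (f vy) (f vy) ℕ.≤-refl ⟩
      f vy - pathProfile i (suc m) ∎))))
    where open ≡-Reasoning

  vp-neighbour-sum : ∀ i j →
    ∑[ i' < n ] ∑[ j' < suc m ]
      ([ adj {suc (suc (suc m))} (vp i j) (vp i' j') ]· (f (vp i j) - f (vp i' j'))) ≡
    extend (λ j' → f (vp i j) - f (vp i j')) (+ 0) (suc (toℕ j)) +
    (+ 0 ◂ extend (λ j' → f (vp i j) - f (vp i j')) (+ 0)) (toℕ j)
  vp-neighbour-sum i j = begin
    ∑[ i' < n ] ∑[ j' < suc m ] ([ ⌊ i ≟ i' ⌋ ∧ C j' ]· (c - f (vp i' j')))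
      ≡⟨ sum-cong-≗ (λ i' → trans (sum-cong-≗ (λ j' → []·-∧ ⌊ i ≟ i' ⌋ (C j') (c - f (vp i' j'))))
                                  (∑-[]· ⌊ i ≟ i' ⌋ (λ j' → [ C j' ]· (c - f (vp i' j'))))) ⟩
    ∑[ i' < n ] ([ ⌊ i ≟ i' ⌋ ]· ∑[ j' < suc m ] ([ C j' ]· (c - f (vp i' j'))))
      ≡⟨ ∑-δ-Fin i (λ i' → ∑[ j' < suc m ] ([ C j' ]· (c - f (vp i' j')))) ⟩
    ∑[ j' < suc m ] ([ C j' ]· t j')
      ≡⟨ sum-cong-≗ split ⟩
    ∑[ j' < suc m ] ([ next j' ]· t j' + [ previous j' ]· t j')
      ≡⟨ ∑-distrib-+ (λ j' → [ next j' ]· t j') (λ j' → [ previous j' ]· t j') ⟩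
    ∑[ j' < suc m ] ([ next j' ]· t j') + ∑[ j' < suc m ] ([ previous j' ]· t j')
      ≡⟨ cong₂ _+_ (trans (sum-cong-≗ (λ j' → cong ([_]· t j') (≡ᵇ-sym (suc p) (toℕ j'))))
                          (∑-δ t (suc p)))
                   (∑-δ-shift t p) ⟩
    extend t (+ 0) (suc p) + (+ 0 ◂ extend t (+ 0)) p ∎
    where
    open ≡-Reasoning
    c : ℤ
    c = f (vp i j)
    p : ℕ
    p = toℕ j
    t : Fin (suc m) → ℤ
    t j' = c - f (vp i j')
    C next previous : Fin (suc m) → Bool
    C j' = (suc p == toℕ j') ∨ (suc (toℕ j') == p)
    next j' = suc p ≡ᵇ toℕ j'
    previous j' = suc (toℕ j') ≡ᵇ p
    split : ∀ j' → [ C j' ]· t j' ≡ [ next j' ]· t j' + [ previous j' ]· t j'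
    split j' = trans (cong (λ b → [ b ]· t j') (cong₂ _∨_ (==-≡ᵇ (suc p) (toℕ j')) (==-≡ᵇ (suc (toℕ j')) p)))
                     ([]·-∨ (next j') (previous j') (suc-≡ᵇ-exclusive p (toℕ j')) (t j'))

  laplacian-vp : ∀ i j → laplacian f (vp i j) ≡ pathLaplacian (pathProfile i) (toℕ j)
  laplacian-vp i j = begin
    laplacian f (vp i j)
      ≡⟨ trans (laplacian-split f (vp i j))
               (cong₂ _+_ (cong ([_]· (c - X)) (==-≡ᵇ p 0))
                          (cong₂ _+_ (cong ([_]· (c - Y)) (==-≡ᵇ (suc p) (suc m))) (vp-neighbour-sum i j))) ⟩
    [ p ≡ᵇ 0 ]· (c - X) + ([ p ≡ᵇ m ]· (c - Y) + (towards-y + towards-x))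
      ≡⟨ interchange ([ p ≡ᵇ 0 ]· (c - X)) ([ p ≡ᵇ m ]· (c - Y)) towards-y towards-x ⟩
    ([ p ≡ᵇ 0 ]· (c - X) + towards-x) + ([ suc p ≡ᵇ suc m ]· (c - Y) + towards-y)
      ≡⟨ cong₂ _+_ (profile-before X h c Y (ℕ.<⇒≤ (toℕ<n j))) (profile-after X h c Y (toℕ<n j)) ⟩
    (c - pathProfile i p) + (c - pathProfile i (suc (suc p)))
      ≡⟨ cong (λ z → (z - pathProfile i p) + (z - pathProfile i (suc (suc p)))) (sym (extend-toℕ h Y j)) ⟩
    pathLaplacian (pathProfile i) p ∎
    where
    open ≡-Reasoning
    X Y c : ℤ
    X = f vx
    Y = f vy
    c = f (vp i j)
    p : ℕ
    p = toℕ j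
    h t : Fin (suc m) → ℤ
    h = f ∘ vp i
    t j' = c - h j'
    towards-x towards-y : ℤ
    towards-x = (+ 0 ◂ extend t (+ 0)) p
    towards-y = extend t (+ 0) (suc p)
    interchange : ∀ a b d e → a + (b + (d + e)) ≡ (a + e) + (b + d)
    interchange = solve-∀

uInd-vp-fsuc : ∀ {m n} j (i : Fin n) (l : Fin m) →
               uInd {suc (suc (suc m))} j (vp i (fsuc l)) ≡ + 0
uInd-vp-fsuc j i l = cong ([_]· + 1) (∧-zeroʳ (toℕ i == j))

etaComb-vanishes : ∀ {k n} (a : Fin (n ∸ 1) → ℕ) v → (∀ j → uInd {k} {n} j v ≡ + 0) →
                   etaComb a v ≡ + 0
etaComb-vanishes {k} {n} a v u≡0 = begin
  sumℤ (map term (allFin (n ∸ 1)))   ≡⟨ sumℤ-map-allFin term ⟩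
  ∑[ i < n ∸ 1 ] term i              ≡⟨ sum-cong-≗ term≡0 ⟩
  ∑[ i < n ∸ 1 ] (+ 0)               ≡⟨ sum-replicate-zero (n ∸ 1) ⟩
  + 0                                ∎
  where
  open ≡-Reasoning
  term : Fin (n ∸ 1) → ℤ
  term i = + a i * eta (toℕ i) v
  term≡0 : ∀ i → term i ≡ + 0
  term≡0 i = trans (cong (+ a i *_) (cong₂ _-_ (u≡0 (toℕ i)) (u≡0 (suc (toℕ i))))) (ℤ.*-zeroʳ (+ a i))

etaComb-vp-fzero : ∀ {m n} (a : Fin (n ∸ 1) → ℕ) (i : Fin n) →
                   etaComb {suc (suc (suc m))} a (vp i fzero) ≡
                   + extend a 0 (toℕ i) - + (0 ◂ extend a 0) (toℕ i)
etaComb-vp-fzero {m} {n} a i = begin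
  sumℤ (map term (allFin (n ∸ 1)))                 ≡⟨ sumℤ-map-allFin term ⟩
  ∑[ i' < n ∸ 1 ] term i'                          ≡⟨ sum-cong-≗ term-split ⟩
  ∑[ i' < n ∸ 1 ] (here i' - previous i')          ≡⟨ ∑-distrib-- here previous ⟩
  sum here - sum previous                          ≡⟨ cong₂ _-_ (∑-δ (+_ ∘ a) q) (∑-δ-shift (+_ ∘ a) q) ⟩
  extend (+_ ∘ a) (+ 0) q - (+ 0 ◂ extend (+_ ∘ a) (+ 0)) q
    ≡⟨ cong₂ _-_ (extend-map +_ a 0 q) (◂-extend-map +_ 0 a 0 q) ⟩
  + extend a 0 q - + (0 ◂ extend a 0) q ∎
  where
  open ≡-Reasoning
  q : ℕ
  q = toℕ i
  term here previous : Fin (n ∸ 1) → ℤ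
  term i' = + a i' * eta {suc (suc (suc m))} (toℕ i') (vp i fzero)
  here i' = [ toℕ i' ≡ᵇ q ]· + a i'
  previous i' = [ suc (toℕ i') ≡ᵇ q ]· + a i'
  at : ∀ r → ((q == r) ∧ true) ≡ (r ≡ᵇ q)
  at r = trans (∧-identityʳ (q == r)) (trans (==-≡ᵇ q r) (≡ᵇ-sym q r))
  term-split : ∀ i' → term i' ≡ here i' - previous i'
  term-split i' =
    trans (*-[]·-difference ((q == toℕ i') ∧ true) ((q == suc (toℕ i')) ∧ true) (+ a i'))
          (cong₂ (λ b b' → [ b ]· + a i' - [ b' ]· + a i') (at (toℕ i')) (at (suc (toℕ i'))))

module _ {m n : ℕ} (a : Fin (n ∸ 1) → ℕ) (a≤ : ∀ i → a i ≤ suc m)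
         (f : HVert (suc (suc (suc m))) n → ℤ)
         (L≡η : ∀ v → laplacian f v ≡ etaComb a v) where

  private
    M : ℤ
    M = + suc (suc m)
    α : ℕ → ℕ
    α = extend a 0
    charge slope : Fin n → ℤ
    charge i = + α (toℕ i) - + (0 ◂ α) (toℕ i)
    slope i = pathProfile f i (suc (suc m)) - pathProfile f i (suc m)

    harmonic-away-from-u : ∀ v → (∀ j → uInd j v ≡ + 0) → laplacian f v ≡ + 0
    harmonic-away-from-u v u≡0 = trans (L≡η v) (etaComb-vanishes a v u≡0)

  path-equations : ∀ i → (pathProfile f i 1 - f vx ≡ charge i + slope i) ×
                         (f vy - f vx ≡ charge i + M * slope i)
  path-equations i =
    proj₁ equations ,
    trans (cong (_- f vx) (sym (profile-end (f vx) (f ∘ vp i) (f vy)))) (proj₂ equations)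
    where
    at-u : pathLaplacian (pathProfile f i) 0 ≡ charge i
    at-u = trans (sym (laplacian-vp f i fzero)) (trans (L≡η (vp i fzero)) (etaComb-vp-fzero {m} a i))
    interior : ∀ p → p < m → pathLaplacian (pathProfile f i) (suc p) ≡ + 0
    interior p p<m = subst (λ r → pathLaplacian (pathProfile f i) r ≡ + 0) (cong suc (toℕ-fromℕ< p<m))
      (trans (sym (laplacian-vp f i (fsuc l)))
             (harmonic-away-from-u (vp i (fsuc l)) (λ j → uInd-vp-fsuc j i l)))
      where
      l : Fin m
      l = fromℕ< p<m
    equations : (pathProfile f i 1 - f vx ≡ charge i + slope i) ×
                (pathProfile f i (suc (suc m)) - f vx ≡ charge i + M * slope i)
    equations = harmonic-path (pathProfile f i) m (charge i) at-u interior

  shared-potentials-agree : f vy - f vx ≡ + 0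
  shared-potentials-agree = ℤ.*-cancelˡ-≡ (M + + n) (f vy - f vx) (+ 0) (trans
    (balance-at-shared-vertices M (f vx) (f vy) (λ i → pathProfile f i 1) charge slope
      (proj₁ ∘ path-equations) (proj₂ ∘ path-equations) at-x at-y)
    (sym (ℤ.*-zeroʳ (M + + n))))
    where
    at-x : + 0 ≡ (f vx - f vy) + ∑[ i < n ] (f vx - pathProfile f i 1)
    at-x = trans (sym (harmonic-away-from-u vx (λ _ → refl))) (laplacian-vx f)
    at-y : + 0 ≡ (f vy - f vx) + sum slope
    at-y = trans (sym (harmonic-away-from-u vy (λ _ → refl))) (trans (laplacian-vy f)
      (cong (_+_ (f vy - f vx)) (sum-cong-≗ (λ i →
        cong (_- pathProfile f i (suc m)) (sym (profile-end (f vx) (f ∘ vp i) (f vy)))))))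

  charge-divisible : ∀ i → M ∣ charge i
  charge-divisible i = divides (- slope i) (begin
    charge i                                  ≡⟨ isolate (charge i) M (slope i) ⟩
    (charge i + M * slope i) + - slope i * M  ≡⟨ cong (_+ - slope i * M) potential-gap ⟩
    + 0 + - slope i * M                       ≡⟨ ℤ.+-identityˡ _ ⟩
    - slope i * M                             ∎)
    where
    open ≡-Reasoning
    potential-gap : charge i + M * slope i ≡ + 0
    potential-gap = trans (sym (proj₂ (path-equations i))) shared-potentials-agree
    isolate : ∀ c M s → c ≡ (c + M * s) + - s * M
    isolate = solve-∀

  η-coefficients-vanish : ∀ i → a i ≡ 0
  η-coefficients-vanish i = trans (sym (extend-toℕ a 0 i))
    (divisible-differences⇒zero α (λ q → s≤s (extend-≤ a a≤ q)) charge-divisible-at (toℕ i) i<n)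
    where
    charge-divisible-at : ∀ q → q < n → M ∣ + α q - + (0 ◂ α) q
    charge-divisible-at q q<n =
      subst (λ r → M ∣ + α r - + (0 ◂ α) r) (toℕ-fromℕ< q<n) (charge-divisible (fromℕ< q<n))
    i<n : toℕ i < n
    i<n = ℕ.<-≤-trans (toℕ<n i) (ℕ.m∸n≤m n 1)

lemma3p3 : (k n : ℕ) → 3 ≤ k → 2 ≤ n →
    (a : Fin (n ∸ 1) → ℕ) → (∀ i → a i ≤ k ∸ 2) →
    etaComb {k} {n} a ∼ zeroDiv →
    ∀ i → a i ≡ 0
lemma3p3 (suc (suc (suc m))) n (s≤s (s≤s (s≤s _))) _ a a≤ (f , η∼L) =
  η-coefficients-vanish a a≤ f (λ v → trans (sym (η∼L v)) (ℤ.+-identityʳ (etaComb a v)))
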